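{- (Bounded Certainty.) Fix a monitoring window $k\ge1$. Let $\tau$ be the monitoring tree of a blockchain run obtained from an initial blockchain run by applying the function $\mathsf{step}$ $l$ times. Then the height of $\tau$ is $\min(l,k)$. Moreover, all leaves of $\tau$ lie in its last level.
   Context: Blockchain model with future monitors. A configuration is a triple $(\Sigma,\Delta,\mathcal U)$ where $\Sigma$ is a blockchain state, $\mathcal U$ the balances of external users, and $\Delta$ a future-monitor context assigning to each contract $c$ a failing map $\mathsf{failmap}_c$ from transaction identifiers to $\{\mathrm{None},\mathrm{Fail},\mathrm{Commit},\mathrm{Undecided}\}$ and a timeout value $\mathsf{timeout}_c(t)\in\{\mathrm{Fail},\mathrm{Commit}\}$. A transaction-execution function $\mathsf{applyTx}(t,n)$ returns either $\mathrm{commit}(n_c)$, $\mathrm{fail}(n_f)$, or $\mathrm{pending}(n_c,n_f)$. A monitoring tree is a finite rooted directed tree whose nodes are configurations; each internal node $n$ has one or two children, all edges out of $n$ are labelled by the same transaction $\mathsf{nextTx}(n)$, and two children are distinguished as committing and failing successor, rooting the committing and failing subtrees. Height = number of edges on a longest root-to-leaf path (a single node has height $0$). A blockchain run is a pair $(H,\tau)$, $H$ a sequence of configurations linked by transactions ending in the root of $\tau$; an initial run has $H_0=\tau_0$ a single configuration. For a leaf $l$ and transaction $t$: $\mathrm{MC}(l,t)=\{c:\mathsf{failmap}_c(t)\neq\mathrm{None}\}$ in $l$; $\mathsf{allMonitoringCommit}(l,t)$ iff all $c\in\mathrm{MC}(l,t)$ have $\mathsf{failmap}_c(t)=\mathrm{Commit}$;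 $\mathsf{oneMonitoringFail}(l,t)$ iff some $c\in\mathrm{MC}(l,t)$ has $\mathsf{failmap}_c(t)=\mathrm{Fail}$; $\mathsf{allMonitoringCommitWithTimeout}(l,t)$ iff every $c\in\mathrm{MC}(l,t)$ has $\mathsf{failmap}_c(t)=\mathrm{Commit}$ or ($\mathrm{Undecided}$ and $\mathsf{timeout}_c(t)=\mathrm{Commit}$). $\mathsf{extend}(\tau,t)$: to each leaf $l$ attach, via edges labelled $t$, the single child $l_c$ if $\mathsf{applyTx}(t,l)=\mathrm{commit}(l_c)$, the single child $l_f$ if $\mathrm{fail}(l_f)$, or committing child $l_c$ and failing child $l_f$ if $\mathrm{pending}(l_c,l_f)$. $\mathsf{innerprune}(\tau)$: a leaf is returned unchanged; with $t=\mathsf{nextTx}(\mathrm{root})$, a root with one successor subtree $\tau_1$ gets the single child $\mathsf{innerprune}(\tau_1)$; a root with subtrees $\tau_c,\tau_f$: let $\tau'_c,\tau'_f$ be their innerprunes; if all leaves of $\tau'_c$ satisfy $\mathsf{allMonitoringCommit}(\cdot,t)$ keep only $\tau'_c$; else if all leaves of $\tau'_c$ satisfy $\mathsf{oneMonitoringFail}(\cdot,t)$ keep only $\tau'_f$; else keep both. $\mathsf{prune}(\tau)$ (height $k+1$): $\tau'=\mathsf{innerprune}(\tau)$; if the root of $\tau'$ has one successor subtree return it; if two, $(\tau_c,\tau_f)$, return $\tau_c$ if every leaf $l$ of $\tau_c$ satisfies $\mathsf{allMonitoringCommitWithTimeout}(l,\mathsf{nextTx}(\mathrm{root}))$, else $\tau_f$.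 $\mathsf{step}((H,\tau),t)$: $\tau'=\mathsf{extend}(\tau,t)$; if height$(\tau')\le k$ return $(H,\tau')$; else $\tau''=\mathsf{prune}(\tau')$, append $\mathrm{root}(\tau)\xrightarrow{\mathsf{nextTx}(\mathrm{root}(\tau))}\mathrm{root}(\tau'')$ to $H$, return $(H,\tau'')$. -}

module Defs where

open import Data.Nat using (ℕ; zero; suc; _≤?_; _⊔_)
open import Data.Bool using (Bool; true; false; _∧_; _∨_; not; if_then_else_)
open import Data.List using (List; []; _∷_; _++_; map; foldl)
open import Data.Bool.ListAction using (all; any)
open import Data.Product using (_×_; _,_; proj₁; proj₂)
open import Relation.Nullary using (yes; no)

data FailVal : Set where
  None Fail Commit Undecided : FailVal

data Timeout : Set where
  TFail TCommit : Timeout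

data TxResult (Config : Set) : Set where
  commit  : Config → TxResult Config
  fail    : Config → TxResult Config
  pending : Config → Config → TxResult Config   -- (committing, failing)

-- A configuration (Σ, Δ, U) is kept abstract; what is observable of Δ is,
-- per configuration, the finite list of contracts, their failing maps and
-- their timeout values.
record Model : Set₁ where
  field
    Config   : Set
    Tx       : Set
    Contract : Set
    contracts : Config → List Contract
    failmap   : Config → Contract → Tx → FailVal
    timeout   : Config → Contract → Tx → Timeout

    applyTx   : Tx → Config → TxResult Config

module Blockchain (M : Model) where
  open Model M

  data MTree : Set where
    leaf  : Config → MTree
    node1 : Config → Tx → MTree → MTree
    node2 : Config → Tx → MTree → MTree → MTree    -- committing, failing

  root : MTree → Config
  root (leaf c)        = c
  root (node1 c _ _)   = c
  root (node2 c _ _ _) = c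

  height : MTree → ℕ
  height (leaf _)          = 0
  height (node1 _ _ τ)     = suc (height τ)
  height (node2 _ _ τc τf) = suc (height τc ⊔ height τf)

  leaves : MTree → List Config
  leaves (leaf c)          = c ∷ []
  leaves (node1 _ _ τ)     = leaves τ
  leaves (node2 _ _ τc τf) = leaves τc ++ leaves τf

  leafDepths : MTree → List ℕ
  leafDepths (leaf _)          = 0 ∷ []
  leafDepths (node1 _ _ τ)     = map suc (leafDepths τ)
  leafDepths (node2 _ _ τc τf) = map suc (leafDepths τc ++ leafDepths τf)

  -- monitor predicates on a leaf l and a transaction t
  -- (c ∈ MC(l,t) iff failmap_c(t) ≠ None)
  allMonitoringCommit : Config → Tx → Bool
  allMonitoringCommit l t = all ok (contracts l)
    where
      ok : Contract → Bool
      ok c with failmap l c t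
      ... | None   = true
      ... | Commit = true
      ... | _      = false

  oneMonitoringFail : Config → Tx → Bool
  oneMonitoringFail l t = any isFail (contracts l)
    where
      isFail : Contract → Bool
      isFail c with failmap l c t
      ... | Fail = true
      ... | _    = false

  allMonitoringCommitWithTimeout : Config → Tx → Bool
  allMonitoringCommitWithTimeout l t = all ok (contracts l)
    where
      ok : Contract → Bool
      ok c with failmap l c t
      ... | None      = true
      ... | Commit    = true
      ... | Undecided with timeout l c t
      ...   | TCommit = true
      ...   | TFail   = false
      ok c | Fail     = false

  extend : MTree → Tx → MTree
  extend (leaf l) t with applyTx t l
  ... | commit lc     = node1 l t (leaf lc)
  ... | fail lf       = node1 l t (leaf lf)
  ... | pending lc lf = node2 l t (leaf lc) (leaf lf)
  extend (node1 c u τ) t       = node1 c u (extend τ t)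
  extend (node2 c u τc τf) t   = node2 c u (extend τc t) (extend τf t)

  innerprune : MTree → MTree
  innerprune (leaf l) = leaf l
  innerprune (node1 c t τ) = node1 c t (innerprune τ)
  innerprune (node2 c t τc τf) =
    if all (λ l → allMonitoringCommit l t) (leaves τc')
    then node1 c t τc'
    else (if all (λ l → oneMonitoringFail l t) (leaves τc')
          then node1 c t τf'
          else node2 c t τc' τf')
    where
      τc' = innerprune τc
      τf' = innerprune τf

  prune : MTree → MTree
  prune τ with innerprune τ
  ... | leaf l            = leaf l      -- does not occur for height k+1 ≥ 1
  ... | node1 _ _ τ₁      = τ₁
  ... | node2 _ t τc τf   =
    if all (λ l → allMonitoringCommitWithTimeout l t) (leaves τc) then τc else τf

  -- History: the sequence of finalized edges (config, tx, config);
  -- it ends in the root of the current monitoring tree.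
  Edge : Set
  Edge = Config × Tx × Config

  Run : Set
  Run = List Edge × MTree

  initialRun : Config → Run
  initialRun c = [] , leaf c

  newEdge : MTree → MTree → List Edge
  newEdge (leaf _)          _   = []
  newEdge (node1 c t _)     τ'' = (c , t , root τ'') ∷ []
  newEdge (node2 c t _ _)   τ'' = (c , t , root τ'') ∷ []

  step : (k : ℕ) → Run → Tx → Run
  step k (H , τ) t with height (extend τ t) ≤? k
  ... | yes _ = H , extend τ t
  ... | no  _ = H ++ newEdge (extend τ t) (prune (extend τ t)) , prune (extend τ t)

  steps : (k : ℕ) → Run → List Tx → Run
  steps k = foldl (step k)

-- Every tree reachable from the initial run is perfect: all its leaves lie at
-- the same depth.  extend adds one full level below every leaf, and pruning only
-- ever selects, at a node, one of two perfect subtrees of equal height, so prune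
-- removes exactly the root level.  Starting from a single leaf, a step thus
-- raises the height h to suc h while suc h ≤ k and keeps it at k afterwards, so
-- after l steps the height is min(l, k).
module Submission where

open import Defs
open import Data.Nat using (ℕ; zero; suc; _+_; _≤_; _⊓_; _≤?_)
open import Data.Nat.Properties
  using (⊔-idem; +-suc; +-identityʳ; ≤-trans; ≤-antisym; n≤1+n; m<1+n⇒m≤n; ≰⇒>; m⊓n≤n; m≤n⇒m⊓n≡m; m≥n⇒m⊓n≡n)
open import Data.List using (List; []; _∷_; length)
open import Data.List.Relation.Unary.All as All using (All; []; _∷_)
open import Data.List.Relation.Unary.All.Properties using (map⁺; ++⁺)
open import Data.Product using (_×_; _,_; proj₂)
open import Data.Bool using (true; false)
open import Data.Bool.ListAction using (all)
open import Relation.Nullary using (¬_; yes; no)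
open import Relation.Binary.PropositionalEquality using (_≡_; refl; cong; sym; trans; subst)

suc-⊓-absorb : ∀ n k → suc (n ⊓ k) ⊓ k ≡ suc n ⊓ k
suc-⊓-absorb n       zero    = refl
suc-⊓-absorb zero    (suc k) = refl
suc-⊓-absorb (suc n) (suc k) = cong suc (suc-⊓-absorb n k)

suc-⊓-saturated : ∀ {h k} → h ≤ k → ¬ suc h ≤ k → suc h ⊓ k ≡ h
suc-⊓-saturated {h} {k} h≤k sh≰k =
  trans (m≥n⇒m⊓n≡n (≤-trans k≤h (n≤1+n h))) (≤-antisym k≤h h≤k)
  where
  k≤h : k ≤ h
  k≤h = m<1+n⇒m≤n (≰⇒> sh≰k)

module _ (M : Model) where
  open Model M
  open Blockchain M

  data Perfect : MTree → ℕ → Set where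
    leaf  : ∀ c → Perfect (leaf c) 0
    node1 : ∀ {h} c t {τ} → Perfect τ h → Perfect (node1 c t τ) (suc h)
    node2 : ∀ {h} c t {τc τf} → Perfect τc h → Perfect τf h → Perfect (node2 c t τc τf) (suc h)

  height-perfect : ∀ {τ h} → Perfect τ h → height τ ≡ h
  height-perfect (leaf c)         = refl
  height-perfect (node1 c t p)    = cong suc (height-perfect p)
  height-perfect (node2 {h} c t pc pf)
    rewrite height-perfect pc | height-perfect pf = cong suc (⊔-idem h)

  leafDepths-perfect : ∀ {τ h} → Perfect τ h → All (_≡ h) (leafDepths τ)
  leafDepths-perfect (leaf c)       = refl ∷ []
  leafDepths-perfect (node1 c t p)  = map⁺ (All.map (cong suc) (leafDepths-perfect p))
  leafDepths-perfect (node2 c t pc pf) =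
    map⁺ (All.map (cong suc) (++⁺ (leafDepths-perfect pc) (leafDepths-perfect pf)))

  extend-perfect : ∀ {τ h} t → Perfect τ h → Perfect (extend τ t) (suc h)
  extend-perfect t (leaf l) with applyTx t l
  ... | commit lc     = node1 l t (leaf lc)
  ... | fail lf       = node1 l t (leaf lf)
  ... | pending lc lf = node2 l t (leaf lc) (leaf lf)
  extend-perfect t (node1 c u p)     = node1 c u (extend-perfect t p)
  extend-perfect t (node2 c u pc pf) = node2 c u (extend-perfect t pc) (extend-perfect t pf)

  innerprune-perfect : ∀ {τ h} → Perfect τ h → Perfect (innerprune τ) h
  innerprune-perfect (leaf c)      = leaf c
  innerprune-perfect (node1 c t p) = node1 c t (innerprune-perfect p)
  innerprune-perfect (node2 c t {τc} pc pf)
    with all (λ l → allMonitoringCommit l t) (leaves (innerprune τc))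
  ... | true = node1 c t (innerprune-perfect pc)
  ... | false with all (λ l → oneMonitoringFail l t) (leaves (innerprune τc))
  ...   | true  = node1 c t (innerprune-perfect pf)
  ...   | false = node2 c t (innerprune-perfect pc) (innerprune-perfect pf)

  prune-perfect : ∀ {h} τ → Perfect τ (suc h) → Perfect (prune τ) h
  prune-perfect τ p with innerprune τ | innerprune-perfect p
  ... | node1 _ _ _    | node1 _ _ p₁ = p₁
  ... | node2 _ t τc _ | node2 _ _ pc pf
    with all (λ l → allMonitoringCommitWithTimeout l t) (leaves τc)
  ...   | true  = pc
  ...   | false = pf

  module _ (k : ℕ) where

    step-perfect : ∀ {τ h} H t → h ≤ k → Perfect τ h → Perfect (proj₂ (step k (H , τ) t)) (suc h ⊓ k)
    step-perfect {τ} {h} H t h≤k p with height (extend τ t) ≤? k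
    ... | yes ext≤k = subst (Perfect _) (sym (m≤n⇒m⊓n≡m sh≤k)) p⁺
      where
      p⁺ : Perfect (extend τ t) (suc h)
      p⁺ = extend-perfect t p
      sh≤k : suc h ≤ k
      sh≤k = subst (_≤ k) (height-perfect p⁺) ext≤k
    ... | no ext≰k = subst (Perfect _) (sym (suc-⊓-saturated h≤k sh≰k)) (prune-perfect (extend τ t) p⁺)
      where
      p⁺ : Perfect (extend τ t) (suc h)
      p⁺ = extend-perfect t p
      sh≰k : ¬ suc h ≤ k
      sh≰k = λ sh≤k → ext≰k (subst (_≤ k) (sym (height-perfect p⁺)) sh≤k)

    steps-perfect : ∀ n r ts → Perfect (proj₂ r) (n ⊓ k) → Perfect (proj₂ (steps k r ts)) ((n + length ts) ⊓ k)
    steps-perfect n r [] p rewrite +-identityʳ n = p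
    steps-perfect n (H , τ) (t ∷ ts) p rewrite +-suc n (length ts) =
      steps-perfect (suc n) (step k (H , τ) t) ts
        (subst (Perfect _) (suc-⊓-absorb n k) (step-perfect H t (m⊓n≤n n k) p))

lemma2 : (M : Model) → (k : ℕ) → 1 ≤ k → (c₀ : Model.Config M) → (ts : List (Model.Tx M)) →
    (Blockchain.height M (proj₂ (Blockchain.steps M k (Blockchain.initialRun M c₀) ts)) ≡ length ts ⊓ k)
    × All (λ d → d ≡ Blockchain.height M (proj₂ (Blockchain.steps M k (Blockchain.initialRun M c₀) ts)))
    (Blockchain.leafDepths M (proj₂ (Blockchain.steps M k (Blockchain.initialRun M c₀) ts)))
lemma2 M k _ c₀ ts =
  height-perfect M perfect , All.map (λ d≡ → trans d≡ (sym (height-perfect M perfect))) (leafDepths-perfect M perfect)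
  where
  perfect : Perfect M (proj₂ (Blockchain.steps M k (Blockchain.initialRun M c₀) ts)) (length ts ⊓ k)
  perfect = steps-perfect M k 0 (Blockchain.initialRun M c₀) ts (leaf c₀)
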